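{- Let $\mathcal{F}$ be an ETL forest whose accessibility relation $\sim$ is transitive and Euclidean and which is initially synchronous. If $\sim$ has $\mathsf{PR_{hc}^\ell}$, then so does $\dot\sim$, the smallest equivalence relation on the set of histories of $\mathcal{F}$ containing $\sim$ (i.e. the S5 closure of $\mathcal{F}$ has $\mathsf{PR_{hc}^\ell}$).
   Context: Fix a finite set $E$ of events. An ETL forest consists of finitely many pairwise disjoint trees, each a copy of a finite prefix-closed set of event sequences with its own root; its set $H$ of histories is the union of the nodes of all trees, and $\sim\subseteq H\times H$ is an arbitrary relation, possibly relating histories in different trees. Within each tree write $h\leadsto h'$ if $h'=he$ for an event $e$, and $\preceq$ for the prefix relation. Euclidean: $h\sim h'$ and $h\sim h''$ imply $h'\sim h''$. Initially synchronous: for any two roots $r,r'$ and any history $h$ with $r\preceq h$ and $r'\sim h$, also $r'\sim r$. A relation $R$ on $H$ has $\mathsf{PR_{hc}^\ell}$ iff for all $h,h'$ and events $e$ with $he\,R\,h'$: (i) $h\,R\,h'$, or (ii) $h\,R\,h''\leadsto h'$ for some $h''$, or (iii) $he\,R\,h''\leadsto h'$ for some $h''$. -}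

module Defs where

open import Level using (0ℓ)
open import Data.Nat using (ℕ; _≤_)
open import Data.Fin using (Fin)
open import Data.Bool using (Bool; T)
open import Data.List using (List; []; _∷ʳ_; _++_; length)
open import Data.Product using (Σ; Σ-syntax; ∃; ∃-syntax; _×_; _,_)
open import Data.Sum using (_⊎_)
open import Relation.Binary using (Rel)
open import Relation.Binary.PropositionalEquality using (_≡_)
open import Relation.Binary.Construct.Closure.Equivalence using (EqClosure)

-- The finite event set E is Fin nE.
-- An ETL forest: m trees, each a finite prefix-closed set of event sequences
-- (given as a Boolean membership predicate), containing the empty sequence
-- (the root of that tree), of bounded length (= finite, since E is finite),
-- together with an arbitrary relation ∼ on the histories.
record PreForest (nE : ℕ) : Set where
  field
    m          : ℕ
    tree       : Fin m → List (Fin nE) → Bool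
    root∈      : ∀ i → T (tree i [])
    prefix-closed : ∀ i (s : List (Fin nE)) (e : Fin nE) → T (tree i (s ∷ʳ e)) → T (tree i s)
    bound      : ℕ
    finite     : ∀ i (s : List (Fin nE)) → T (tree i s) → length s ≤ bound

  -- histories: a node in one of the trees (trees are disjoint copies)
  History : Set
  History = Σ[ i ∈ Fin m ] Σ[ s ∈ List (Fin nE) ] T (tree i s)

  root : Fin m → History
  root i = i , [] , root∈ i

  data _⇝_ : History → History → Set where
    step : ∀ i s e (p : T (tree i s)) (q : T (tree i (s ∷ʳ e))) →
           (i , s , p) ⇝ (i , s ∷ʳ e , q)

  data _⪯_ : History → History → Set where
    pre : ∀ i s t (p : T (tree i s)) (q : T (tree i (s ++ t))) →
          (i , s , p) ⪯ (i , s ++ t , q)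

record ETLForest (nE : ℕ) : Set₁ where
  field
    pf  : PreForest nE
  open PreForest pf public
  field
    _∼_ : Rel History 0ℓ

module _ {nE : ℕ} (F : PreForest nE) where
  open PreForest F

  Transitive∼ : Rel History 0ℓ → Set
  Transitive∼ R = ∀ {a b c} → R a b → R b c → R a c

  Euclidean : Rel History 0ℓ → Set
  Euclidean R = ∀ {h h' h''} → R h h' → R h h'' → R h' h''

  InitiallySynchronous : Rel History 0ℓ → Set
  InitiallySynchronous R = ∀ (r r' : Fin m) (h : History) →
    root r ⪯ h → R (root r') h → R (root r') (root r)

  PRhcℓ : Rel History 0ℓ → Set
  PRhcℓ R = ∀ (i : Fin m) (s : List (Fin nE)) (e : Fin nE)
    (p : T (tree i s)) (q : T (tree i (s ∷ʳ e))) (h' : History) →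
    let h = (i , s , p) ; he = (i , s ∷ʳ e , q) in
    R he h' →
    R h h' ⊎ (∃[ h'' ] (R h h'' × h'' ⇝ h')) ⊎ (∃[ h'' ] (R he h'' × h'' ⇝ h'))

  S5Closure : Rel History 0ℓ → Rel History 0ℓ
  S5Closure R = EqClosure R

-- For a transitive Euclidean ∼, two histories are related by its equivalence closure
-- iff they are equal or have a common ∼-successor c. So if he and h' are related and
-- distinct, pick c with he ∼ c and h' ∼ c and induct on the depth of c. If h' is a
-- root, initial synchrony gives h' ∼ r for the root r of c's tree, hence he ∼ r, and
-- PR_hc^ℓ for ∼ then forces h ∼ r since roots have no parent.
-- Otherwise h' = g f, and PR_hc^ℓ applied to h' ∼ c either lands directly, passes
-- to the parent of c (where the induction hypothesis applies), or gives g ∼ parent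
-- of c; in the last case PR_hc^ℓ applied to he ∼ c relates h or he to that same
-- parent, since parents are unique.
module Submission where

open import Defs
open import Data.Nat using (ℕ; _<_; s≤s; z≤n)
open import Data.Nat.Properties using (m<m+n; n≮0)
open import Data.Nat.Induction using (<-wellFounded)
open import Data.Empty using (⊥-elim)
open import Data.Fin using (Fin)
open import Data.Bool using (T)
open import Data.Bool.Properties using (T-irrelevant)
open import Data.List using (List; []; _∷ʳ_; length; InitLast; initLast; _∷ʳ′_)
open import Data.List.Properties using (length-++; ∷ʳ-injectiveˡ)
open import Data.Product using (∃-syntax; _×_; _,_; proj₁; proj₂)
open import Data.Sum using (_⊎_; inj₁; inj₂)
open import Function using (_∘_)
open import Induction.WellFounded using (WellFounded; Acc; acc; module Subrelation)
open import Relation.Binary using (Rel; Transitive)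
open import Relation.Binary.PropositionalEquality using (_≡_; refl; sym; cong; subst)
open import Relation.Binary.Construct.Closure.Equivalence using (EqClosure)
open import Relation.Binary.Construct.Closure.Symmetric using (SymClosure; fwd; bwd)
open import Relation.Binary.Construct.Closure.ReflexiveTransitive using (ε; _◅_)
import Relation.Binary.Construct.On as On
open import Relation.Nullary using (¬_)

module Joinability {a ℓ} {A : Set a} (R : Rel A ℓ) where

  Joinable : Rel A _
  Joinable x y = ∃[ z ] (R x z × R y z)

  joinable⇒eqClosure : ∀ {x y} → Joinable x y → EqClosure R x y
  joinable⇒eqClosure (_ , xRz , yRz) = fwd xRz ◅ bwd yRz ◅ ε

  module TransitiveEuclidean (trans-R : Transitive R)
           (eucl-R : ∀ {x y z} → R x y → R x z → R y z) where

    zigzag : ∀ {w x y z} → R w x → R y x → R y z → R w z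
    zigzag wRx yRx yRz = trans-R wRx (eucl-R yRx yRz)

    joinable-trans : Transitive Joinable
    joinable-trans (_ , xRu , yRu) (v , yRv , zRv) = v , zigzag xRu yRu yRv , zRv

    symClosure⇒joinable : ∀ {x y} → SymClosure R x y → Joinable x y
    symClosure⇒joinable (fwd xRy) = _ , xRy , eucl-R xRy xRy
    symClosure⇒joinable (bwd yRx) = _ , eucl-R yRx yRx , yRx

    eqClosure⇒≡⊎joinable : ∀ {x y} → EqClosure R x y → x ≡ y ⊎ Joinable x y
    eqClosure⇒≡⊎joinable ε = inj₁ refl
    eqClosure⇒≡⊎joinable (step ◅ rest) with eqClosure⇒≡⊎joinable rest
    ... | inj₁ refl = inj₂ (symClosure⇒joinable step)
    ... | inj₂ j    = inj₂ (joinable-trans (symClosure⇒joinable step) j)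

module Forest {nE : ℕ} (F : PreForest nE) where
  open PreForest F

  depth : History → ℕ
  depth (_ , s , _) = length s

  ⇝-depth : ∀ {g h} → g ⇝ h → depth g < depth h
  ⇝-depth (step i s e p q) =
    subst (length s <_) (sym (length-++ s)) (m<m+n (length s) (s≤s z≤n))

  ⇝-wellFounded : WellFounded _⇝_
  ⇝-wellFounded =
    Subrelation.wellFounded ⇝-depth (On.wellFounded depth <-wellFounded)

  root-has-no-parent : ∀ {g} r → ¬ (g ⇝ root r)
  root-has-no-parent r g⇝r = n≮0 (⇝-depth g⇝r)

  root⪯ : ∀ i s (p : T (tree i s)) → root i ⪯ (i , s , p)
  root⪯ i s p = pre i [] s (root∈ i) p

  History-≡ : ∀ {i j s t p q} → i ≡ j → s ≡ t →
              _≡_ {A = History} (i , s , p) (j , t , q)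
  History-≡ {p = p} {q} refl refl with T-irrelevant p q
  ... | refl = refl

  ⇝-parent-unique : ∀ {g g′ h} → g ⇝ h → g′ ⇝ h → g ≡ g′
  ⇝-parent-unique (step i s e p q) g′⇝h = unique g′⇝h refl
    where
    unique : ∀ {g′ h} → g′ ⇝ h → h ≡ (i , s ∷ʳ e , q) → (i , s , p) ≡ g′
    unique (step _ s′ _ _ _) eq =
      History-≡ (sym (cong proj₁ eq)) (sym (∷ʳ-injectiveˡ s′ s (cong (proj₁ ∘ proj₂) eq)))

  data RootOrSuccessor : History → Set where
    isRoot      : ∀ r → RootOrSuccessor (root r)
    isSuccessor : ∀ {g h} → g ⇝ h → RootOrSuccessor h

  rootOrSuccessor : ∀ h → RootOrSuccessor h
  rootOrSuccessor (i , s , p) = view (initLast s) p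
    where
    view : ∀ {s} → InitLast s → (p : T (tree i s)) → RootOrSuccessor (i , s , p)
    view []         p with T-irrelevant p (root∈ i)
    ... | refl = isRoot i
    view (s ∷ʳ′ e) p = isSuccessor (step i s e (prefix-closed i s e p) p)

module _ {nE : ℕ} (F : ETLForest nE) where
  open ETLForest F
  open Forest pf
  open Joinability _∼_

  module _ (trans-∼ : Transitive∼ pf _∼_) (eucl-∼ : Euclidean pf _∼_)
           (sync-∼ : InitiallySynchronous pf _∼_) (pr-∼ : PRhcℓ pf _∼_) where

    open TransitiveEuclidean trans-∼ eucl-∼

    ∼-unique-parent : ∀ {g k k′ c} → g ∼ k → k ⇝ c → k′ ⇝ c → g ∼ k′
    ∼-unique-parent {g} g∼k k⇝c k′⇝c = subst (g ∼_) (⇝-parent-unique k⇝c k′⇝c) g∼k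

    _≈_ : Rel History _
    _≈_ = S5Closure pf _∼_

    module _ (i : Fin m) (s : List (Fin nE)) (e : Fin nE)
             (p : T (tree i s)) (q : T (tree i (s ∷ʳ e))) where

      private
        h he : History
        h  = i , s , p
        he = i , s ∷ʳ e , q

      Conclusion : History → Set
      Conclusion h′ = h ≈ h′ ⊎ (∃[ h″ ] (h ≈ h″ × h″ ⇝ h′)) ⊎ (∃[ h″ ] (he ≈ h″ × h″ ⇝ h′))

      conclusion-root : ∀ {c} r → he ∼ c → root r ∼ c → Conclusion (root r)
      conclusion-root {c@(i₀ , u , pc)} r he∼c r∼c
        with r∼r₀ ← sync-∼ i₀ r c (root⪯ i₀ u pc) r∼c
        with pr-∼ i s e p q (root i₀) (zigzag he∼c r∼c r∼r₀)
      ... | inj₁ h∼r₀                 = inj₁ (joinable⇒eqClosure (_ , h∼r₀ , r∼r₀))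
      ... | inj₂ (inj₁ (_ , _ , g⇝r₀)) = ⊥-elim (root-has-no-parent i₀ g⇝r₀)
      ... | inj₂ (inj₂ (_ , _ , g⇝r₀)) = ⊥-elim (root-has-no-parent i₀ g⇝r₀)

      conclusion-sibling : ∀ {g h′ k c} → g ⇝ h′ → g ∼ k → k ⇝ c → he ∼ c → h′ ∼ c →
                           Conclusion h′
      conclusion-sibling {g} g⇝h′ g∼k k⇝c he∼c h′∼c with pr-∼ i s e p q _ he∼c
      ... | inj₁ h∼c = inj₁ (joinable⇒eqClosure (_ , h∼c , h′∼c))
      ... | inj₂ (inj₁ (k′ , h∼k′ , k′⇝c)) =
        inj₂ (inj₁ (g , joinable⇒eqClosure (k′ , h∼k′ , ∼-unique-parent g∼k k⇝c k′⇝c) , g⇝h′))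
      ... | inj₂ (inj₂ (k′ , he∼k′ , k′⇝c)) =
        inj₂ (inj₂ (g , joinable⇒eqClosure (k′ , he∼k′ , ∼-unique-parent g∼k k⇝c k′⇝c) , g⇝h′))

      conclusion : ∀ {c h′} → Acc _⇝_ c → he ∼ c → h′ ∼ c → Conclusion h′
      conclusion {h′ = h′} (acc below) he∼c h′∼c with rootOrSuccessor h′
      ... | isRoot r = conclusion-root r he∼c h′∼c
      ... | isSuccessor g⇝h′@(step j t f pt qt) with pr-∼ j t f pt qt _ h′∼c
      ...   | inj₁ g∼c =
        inj₂ (inj₂ (_ , joinable⇒eqClosure (_ , he∼c , g∼c) , g⇝h′))
      ...   | inj₂ (inj₁ (_ , g∼k , k⇝c)) = conclusion-sibling g⇝h′ g∼k k⇝c he∼c h′∼c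
      ...   | inj₂ (inj₂ (_ , h′∼k , k⇝c)) =
        conclusion (below k⇝c) (zigzag he∼c h′∼c h′∼k) h′∼k

    S5Closure-PRhcℓ : PRhcℓ pf _≈_
    S5Closure-PRhcℓ i s e p q h′ he≈h′
      with eqClosure⇒≡⊎joinable he≈h′
    ... | inj₁ refl = inj₂ (inj₁ (_ , ε , step i s e p q))
    ... | inj₂ (c , he∼c , h′∼c) =
      conclusion i s e p q (⇝-wellFounded c) he∼c h′∼c

lemma4 : ∀ {nE} (F : ETLForest nE) →
    let open ETLForest F in
    Transitive∼ pf _∼_ → Euclidean pf _∼_ → InitiallySynchronous pf _∼_ →
    PRhcℓ pf _∼_ → PRhcℓ pf (S5Closure pf _∼_)
lemma4 = S5Closure-PRhcℓ
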